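{- Let $G=(X,Y,E)$ be a 2-layer network and $<_X$ a linear order of $X$ such that the one-sided local crossing number of $(G,<_X)$ is $k$. Then every valley $\langle w,y,x\rangle$ of $G$ has at most $2k$ intrusive edges.
   Context: A 2-layer network $(X,Y,E)$ is a finite bipartite graph with vertex set $X\cup Y$, $X\cap Y=\emptyset$, edges written $(x,y)$ with $x\in X,y\in Y$. A 2-layer drawing is a pair $(<_X,<_Y)$ of linear orders of $X$ and $Y$; edges $(x_1,y_1),(x_2,y_2)$ cross iff $(x_1<_X x_2\wedge y_2<_Y y_1)$ or $(x_2<_X x_1\wedge y_1<_Y y_2)$. The local crossing number of a drawing is the minimum $k$ such that every edge crosses at most $k$ edges; the one-sided local crossing number of $(G,<_X)$ is the minimum over all linear orders $<_Y$ of $Y$ of the local crossing number of $(<_X,<_Y)$. Two edges $(w,y),(x,y)\in E$ with $w<_X x$ form a valley $\langle w,y,x\rangle$. For such a valley, an edge $(x',y')\in E$ with $y'\neq y$ and $w<_X x'<_X x$ is an intrusive edge. -}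

module Defs where

open import Data.Nat using (ℕ; _≤_; _<_)
open import Data.Nat.Properties using (_<?_)
open import Data.Fin using (Fin; toℕ)
open import Data.Fin.Properties using (_≟_)
open import Data.Fin.Permutation using (Permutation′; _⟨$⟩ʳ_)
open import Data.Bool using (Bool; true; false; T)
open import Data.List using (List; allFin; cartesianProduct; filter; length)
open import Data.Product using (_×_; _,_; Σ; ∃)
open import Data.Sum using (_⊎_)
open import Relation.Nullary using (¬_; Dec)
open import Relation.Nullary.Decidable using (_×-dec_; _⊎-dec_; ¬?)
open import Data.Bool.Properties using (T?)

-- A 2-layer network with |X| = m, |Y| = n: X = Fin m, Y = Fin n,
-- the edge set E ⊆ X × Y given by its characteristic function.
record Network (m n : ℕ) : Set where
  field
    edge : Fin m → Fin n → Bool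

open Network public

-- A linear order on Fin k is given by a ranking bijection π : Fin k ≃ Fin k;
-- a <_π b  iff  π a < π b.
Order : ℕ → Set
Order k = Permutation′ k

_<[_]_ : ∀ {k} → Fin k → Order k → Fin k → Set
a <[ π ] b = toℕ (π ⟨$⟩ʳ a) < toℕ (π ⟨$⟩ʳ b)

_<[_]?_ : ∀ {k} (a : Fin k) (π : Order k) (b : Fin k) → Dec (a <[ π ] b)
a <[ π ]? b = toℕ (π ⟨$⟩ʳ a) <? toℕ (π ⟨$⟩ʳ b)

pairs : (m n : ℕ) → List (Fin m × Fin n)
pairs m n = cartesianProduct (allFin m) (allFin n)

Cross : ∀ {m n} → Order m → Order n → Fin m × Fin n → Fin m × Fin n → Set
Cross oX oY (x₁ , y₁) (x₂ , y₂) =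
  (x₁ <[ oX ] x₂ × y₂ <[ oY ] y₁) ⊎ (x₂ <[ oX ] x₁ × y₁ <[ oY ] y₂)

cross? : ∀ {m n} (oX : Order m) (oY : Order n) (e f : Fin m × Fin n) → Dec (Cross oX oY e f)
cross? oX oY (x₁ , y₁) (x₂ , y₂) =
  ((x₁ <[ oX ]? x₂) ×-dec (y₂ <[ oY ]? y₁)) ⊎-dec ((x₂ <[ oX ]? x₁) ×-dec (y₁ <[ oY ]? y₂))

crossings : ∀ {m n} → Network m n → Order m → Order n → Fin m × Fin n → ℕ
crossings {m} {n} G oX oY e =
  length (filter (λ f → T? (edge G (Data.Product.proj₁ f) (Data.Product.proj₂ f)) ×-dec cross? oX oY e f) (pairs m n))

LCNBound : ∀ {m n} → Network m n → Order m → Order n → ℕ → Set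
LCNBound G oX oY j = ∀ x y → T (edge G x y) → crossings G oX oY (x , y) ≤ j

LocalCrossingNumber : ∀ {m n} → Network m n → Order m → Order n → ℕ → Set
LocalCrossingNumber G oX oY k = LCNBound G oX oY k × (∀ j → LCNBound G oX oY j → k ≤ j)

OneSidedLCN : ∀ {m n} → Network m n → Order m → ℕ → Set
OneSidedLCN {m} {n} G oX k =
  (Σ (Order n) λ oY → LocalCrossingNumber G oX oY k) ×
  (∀ (oY : Order n) k′ → LocalCrossingNumber G oX oY k′ → k ≤ k′)

Valley : ∀ {m n} → Network m n → Order m → Fin m → Fin n → Fin m → Set
Valley G oX w y x = T (edge G w y) × T (edge G x y) × w <[ oX ] x

intrusive : ∀ {m n} → Network m n → Order m → Fin m → Fin n → Fin m → ℕ
intrusive {m} {n} G oX w y x =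
  length (filter (λ f → T? (edge G (Data.Product.proj₁ f) (Data.Product.proj₂ f))
                         ×-dec ¬? (Data.Product.proj₂ f ≟ y)
                         ×-dec (w <[ oX ]? Data.Product.proj₁ f)
                         ×-dec (Data.Product.proj₁ f <[ oX ]? x))
                 (pairs m n))

{-# OPTIONS --safe #-}
-- Fix a drawing (<X , <Y) whose local crossing number is k. An intrusive edge
-- (x′ , y′) of ⟨ w , y , x ⟩ has y′ ≠ y, so y′ lies left or right of y: on the
-- left it crosses (w , y), on the right it crosses (x , y). Hence the intrusive
-- edges are among the at most k + k edges crossed by the two valley edges.
module Submission where

open import Defs
open import Data.Nat using (ℕ; _≤_; _*_; _+_; z≤n; s≤s)
open import Data.Nat.Properties
  using (≤-refl; ≤-reflexive; ≤-trans; n≤1+n; +-mono-≤; +-suc; +-identityʳ; <-cmp; module ≤-Reasoning)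
open import Data.Fin using (Fin; toℕ)
open import Data.Fin.Properties using (toℕ-injective)
open import Data.Fin.Permutation using (_⟨$⟩ʳ_)
open import Data.List using ([]; _∷_; filter; length)
open import Data.List.Properties using (filter-accept)
open import Data.Product using (_,_)
open import Data.Sum using (_⊎_; inj₁; inj₂) renaming (map to ⊎-map)
open import Function.Bundles using (Injection)
open import Function.Properties.Inverse using (↔⇒↣)
open import Relation.Nullary using (yes; no; contradiction)
open import Relation.Unary using (Pred; Decidable; _⊆_; _∪_)
open import Relation.Binary.Definitions using (tri<; tri≈; tri>)
open import Relation.Binary.PropositionalEquality using (_≢_; cong; sym)

module _ {ℓ} {A : Set ℓ} where

  length-filter-∷ : ∀ {p} {P : Pred A p} (P? : Decidable P) a xs →
    length (filter P? xs) ≤ length (filter P? (a ∷ xs))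
  length-filter-∷ P? a xs with P? a
  ... | yes _ = n≤1+n _
  ... | no  _ = ≤-refl

  length-filter-≤-+ : ∀ {p q r} {P : Pred A p} {Q : Pred A q} {R : Pred A r}
    (P? : Decidable P) (Q? : Decidable Q) (R? : Decidable R) →
    P ⊆ Q ∪ R → ∀ xs → length (filter P? xs) ≤ length (filter Q? xs) + length (filter R? xs)
  length-filter-≤-+ P? Q? R? P⊆Q∪R [] = z≤n
  length-filter-≤-+ P? Q? R? P⊆Q∪R (a ∷ xs) with ih ← length-filter-≤-+ P? Q? R? P⊆Q∪R xs | P? a
  ... | no _  = ≤-trans ih (+-mono-≤ (length-filter-∷ Q? a xs) (length-filter-∷ R? a xs))
  ... | yes p with P⊆Q∪R p
  ...   | inj₁ q = ≤-trans (s≤s ih)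
    (+-mono-≤ (≤-reflexive (cong length (sym (filter-accept Q? q)))) (length-filter-∷ R? a xs))
  ...   | inj₂ r = ≤-trans (s≤s ih) (≤-trans (≤-reflexive (sym (+-suc _ _)))
    (+-mono-≤ (length-filter-∷ Q? a xs) (≤-reflexive (cong length (sym (filter-accept R? r))))))

≢⇒<[]⊎>[] : ∀ {k} (π : Order k) {a b : Fin k} → a ≢ b → a <[ π ] b ⊎ b <[ π ] a
≢⇒<[]⊎>[] π {a} {b} a≢b with <-cmp (toℕ (π ⟨$⟩ʳ a)) (toℕ (π ⟨$⟩ʳ b))
... | tri< a<b _ _ = inj₁ a<b
... | tri≈ _ a≈b _ = contradiction (Injection.injective (↔⇒↣ π) (toℕ-injective a≈b)) a≢b
... | tri> _ _ b<a = inj₂ b<a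

intrusive-crosses-valley : ∀ {m n} (oX : Order m) (oY : Order n) {w x x′ : Fin m} {y y′ : Fin n} →
  y′ ≢ y → w <[ oX ] x′ → x′ <[ oX ] x →
  Cross oX oY (w , y) (x′ , y′) ⊎ Cross oX oY (x , y) (x′ , y′)
intrusive-crosses-valley oX oY y′≢y w<x′ x′<x with ≢⇒<[]⊎>[] oY y′≢y
... | inj₁ y′<y = inj₁ (inj₁ (w<x′ , y′<y))
... | inj₂ y<y′ = inj₂ (inj₂ (x′<x , y<y′))

intrusive≤crossings+crossings : ∀ {m n} (G : Network m n) (oX : Order m) (oY : Order n) w y x →
  intrusive G oX w y x ≤ crossings G oX oY (w , y) + crossings G oX oY (x , y)
intrusive≤crossings+crossings {m} {n} G oX oY w y x =
  length-filter-≤-+ _ _ _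
    (λ { {x′ , y′} (e , y′≢y , w<x′ , x′<x) →
           ⊎-map (e ,_) (e ,_) (intrusive-crosses-valley oX oY y′≢y w<x′ x′<x) })
    (pairs m n)

lemma6 : ∀ {m n} (G : Network m n) (oX : Order m) (k : ℕ) →
           OneSidedLCN G oX k →
           ∀ (w : Fin m) (y : Fin n) (x : Fin m) → Valley G oX w y x →
           intrusive G oX w y x ≤ 2 * k
lemma6 G oX k ((oY , bound , _) , _) w y x (wy∈E , xy∈E , _) = begin
  intrusive G oX w y x                                  ≤⟨ intrusive≤crossings+crossings G oX oY w y x ⟩
  crossings G oX oY (w , y) + crossings G oX oY (x , y) ≤⟨ +-mono-≤ (bound w y wy∈E) (bound x y xy∈E) ⟩
  k + k                                                 ≡⟨ cong (k +_) (sym (+-identityʳ k)) ⟩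
  2 * k                                                 ∎
  where open ≤-Reasoning
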